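{- Let $T$ be a rooted tree with leaf set $\mathcal{S}$ and no subdivision node, and let $\mathcal{C}$ be a set of characters on $\mathcal{S}$ such that $T$ is galled-completable for $\mathcal{C}$. Then for every $C\in\mathcal{C}$, $|\mathrm{FA}_T(C)|\le 2$.
   Context: A network is a finite directed acyclic graph with a unique node of in-degree $0$ (the root); a leaf has in-degree $1$ and out-degree $0$; subdivision nodes are allowed. An underlying cycle is a cycle of the underlying undirected (multi)graph; two are distinct if they use different edge sets. A network is a galled tree if no two distinct underlying cycles share a node. A tree is a network with no underlying cycle; $L_T(v)$ is the set of leaves descending from $v$. An LGT network is a network $N=(V,E_S\cup E_T)$ with a specified partition of its edges into support edges $E_S$ and transfer edges $E_T$ such that $(V,E_S)$ is a tree $\overline{N}$ (the support tree), both endpoints of every transfer edge are incomparable in $\overline{N}$, and every endpoint of a transfer edge has exactly one child in $\overline{N}$. The base tree of $N$ is obtained from $\overline{N}$ by suppressing subdivision nodes. A character is a subset of $\mathcal{S}$; $F_C(N)$ is the set of nodes $v$ such that some leaf descending from $v$ in $\overline{N}$ is not in $C$; $N$ explains $\mathcal{C}$ if for every $C\in\mathcal{C}$, $N-F_C(N)$ contains a node reaching every leaf of $C$ within $N-F_C(N)$. $T$ is galled-completable for $\mathcal{C}$ if some LGT network that is a galled tree, has leaf set $\mathcal{S}$ and base tree $T$, explains $\mathcal{C}$. A node $v$ of $T$ is a first-appearance (FA) node for $C$ if $L_T(v)\subseteq C$ and either $v$ is the root or its parent $u$ satisfies $L_T(u)\not\subseteq C$; $\mathrm{FA}_T(C)$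 is the set of such nodes. -}

module Defs where

open import Data.Nat using (ℕ; zero; suc; _<?_; s≤s)
open import Data.Fin using (Fin; zero; suc; toℕ; fromℕ<)
open import Data.Bool using (Bool; true; false)
open import Data.Product using (Σ; ∃; ∃-syntax; _×_; _,_)
open import Data.Sum using (_⊎_)
open import Data.Unit using (⊤)
open import Relation.Nullary using (¬_; yes; no)
open import Relation.Binary.PropositionalEquality using (_≡_; _≢_)
open import Function using (Injective)

-- Finite directed multigraphs: nodes Fin n, edges Fin m (edges are
-- distinguished by their index, so parallel edges are allowed).

record Graph : Set where
  field
    n   : ℕ
    m   : ℕ
    src : Fin m → Fin n
    tgt : Fin m → Fin n

open Graph public

next : ∀ {k} → Fin (suc k) → Fin (suc k)
next {k} i with suc (toℕ i) <? suc k
... | yes p = fromℕ< p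
... | no _  = zero

-- All notions below are relative to a graph G and a predicate E selecting
-- which edges are present (all edges for N, the support edges for N̄).
module _ (G : Graph) (E : Fin (m G) → Set) where

  InDeg0 : Fin (n G) → Set
  InDeg0 v = ∀ e → E e → tgt G e ≢ v

  OutDeg0 : Fin (n G) → Set
  OutDeg0 v = ∀ e → E e → src G e ≢ v

  InDeg1 : Fin (n G) → Set
  InDeg1 v = ∃[ e ] (E e × tgt G e ≡ v × (∀ e′ → E e′ → tgt G e′ ≡ v → e′ ≡ e))

  OutDeg1 : Fin (n G) → Set
  OutDeg1 v = ∃[ e ] (E e × src G e ≡ v × (∀ e′ → E e′ → src G e′ ≡ v → e′ ≡ e))

  Leaf : Fin (n G) → Set
  Leaf v = InDeg1 v × OutDeg0 v

  Subdiv : Fin (n G) → Set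
  Subdiv v = InDeg1 v × OutDeg1 v

  IsChild : Fin (n G) → Fin (n G) → Set
  IsChild u w = ∃[ e ] (E e × src G e ≡ u × tgt G e ≡ w)

  ExactlyOneChild : Fin (n G) → Set
  ExactlyOneChild u = ∃[ w ] (IsChild u w × (∀ w′ → IsChild u w′ → w′ ≡ w))

  data Path (Q : Fin (n G) → Set) : Fin (n G) → Fin (n G) → Set where
    stop : ∀ {u} → Q u → Path Q u u
    step : ∀ {u v} (e : Fin (m G)) → E e → src G e ≡ u → Q u →
           Path Q (tgt G e) v → Path Q u v

  Reach : Fin (n G) → Fin (n G) → Set
  Reach = Path (λ _ → ⊤)

  Comparable : Fin (n G) → Fin (n G) → Set
  Comparable u v = Reach u v ⊎ Reach v u

  IsNetwork : Set
  IsNetwork = (∀ e → E e → ¬ Reach (tgt G e) (src G e))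
            × (∃[ r ] (InDeg0 r × (∀ v → InDeg0 v → v ≡ r)))

  joins : Fin (m G) → Fin (n G) → Fin (n G) → Set
  joins e a b = (src G e ≡ a × tgt G e ≡ b) ⊎ (src G e ≡ b × tgt G e ≡ a)

  record Cycle : Set where
    field
      k     : ℕ
      vs    : Fin (suc (suc k)) → Fin (n G)
      es    : Fin (suc (suc k)) → Fin (m G)
      vs-inj : Injective _≡_ _≡_ vs
      es-inj : Injective _≡_ _≡_ es
      es-E  : ∀ i → E (es i)
      es-join : ∀ i → joins (es i) (vs i) (vs (next i))

  NodeOn : Fin (n G) → Cycle → Set
  NodeOn v c = ∃[ i ] (Cycle.vs c i ≡ v)

  EdgeOn : Fin (m G) → Cycle → Set
  EdgeOn e c = ∃[ i ] (Cycle.es c i ≡ e)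

  SameEdgeSet : Cycle → Cycle → Set
  SameEdgeSet c₁ c₂ = ∀ e → (EdgeOn e c₁ → EdgeOn e c₂) × (EdgeOn e c₂ → EdgeOn e c₁)

  IsTree : Set
  IsTree = IsNetwork × ¬ Cycle

  IsGalledTree : Set
  IsGalledTree = IsNetwork ×
    (∀ (c₁ c₂ : Cycle) → ¬ SameEdgeSet c₁ c₂ → ¬ (∃[ v ] (NodeOn v c₁ × NodeOn v c₂)))

  -- path of length ≥ 1 from u to v all of whose internal nodes are
  -- subdivision nodes (an edge of the graph after suppressing them)
  data SuppEdge : Fin (n G) → Fin (n G) → Set where
    direct : ∀ {u v} e → E e → src G e ≡ u → tgt G e ≡ v → SuppEdge u v
    via    : ∀ {u v} e → E e → src G e ≡ u → Subdiv (tgt G e) →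
             SuppEdge (tgt G e) v → SuppEdge u v

AllE : ∀ {G : Graph} → Fin (m G) → Set
AllE _ = ⊤

-- LGT networks: isT e ≡ true marks transfer edges, false support edges.

SupportE : (G : Graph) → (Fin (m G) → Bool) → Fin (m G) → Set
SupportE G isT e = isT e ≡ false

record IsLGT (G : Graph) (isT : Fin (m G) → Bool) : Set where
  field
    network     : IsNetwork G (AllE {G})
    supportTree : IsTree G (SupportE G isT)
    incomparable : ∀ e → isT e ≡ true →
                   ¬ Comparable G (SupportE G isT) (src G e) (tgt G e)
    srcOneChild : ∀ e → isT e ≡ true → ExactlyOneChild G (SupportE G isT) (src G e)
    tgtOneChild : ∀ e → isT e ≡ true → ExactlyOneChild G (SupportE G isT) (tgt G e)

Character : Graph → Set
Character T = Fin (n T) → Bool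

IsCharacter : (T : Graph) → Character T → Set
IsCharacter T C = ∀ v → C v ≡ true → Leaf T (AllE {T}) v

-- φ identifies T with the base tree of N (support tree with subdivision
-- nodes suppressed), and the leaves of N with the leaf set S of T.
record BaseTreeIso (T N : Graph) (isT : Fin (m N) → Bool)
                   (φ : Fin (n T) → Fin (n N)) : Set where
  field
    φ-inj      : Injective _≡_ _≡_ φ
    φ-nonsub   : ∀ v → ¬ Subdiv N (SupportE N isT) (φ v)
    φ-onto     : ∀ w → ¬ Subdiv N (SupportE N isT) w → ∃[ v ] (φ v ≡ w)
    φ-edge     : ∀ u v → IsChild T (AllE {T}) u v → SuppEdge N (SupportE N isT) (φ u) (φ v)
    φ-edge⁻¹   : ∀ u v → SuppEdge N (SupportE N isT) (φ u) (φ v) → IsChild T (AllE {T}) u v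
    leaf-to    : ∀ v → Leaf T (AllE {T}) v → Leaf N (AllE {N}) (φ v)
    leaf-from  : ∀ w → Leaf N (AllE {N}) w → ∃[ v ] (Leaf T (AllE {T}) v × φ v ≡ w)

module _ (N : Graph) (isT : Fin (m N) → Bool) (C′ : Fin (n N) → Set) where

  F : Fin (n N) → Set
  F v = ∃[ ℓ ] (Leaf N (AllE {N}) ℓ × Reach N (SupportE N isT) v ℓ × ¬ C′ ℓ)

  Explains : Set
  Explains = ∃[ u ] (¬ F u × (∀ ℓ → C′ ℓ → Path N (AllE {N}) (λ w → ¬ F w) u ℓ))

transport : (T N : Graph) → (Fin (n T) → Fin (n N)) → Character T → Fin (n N) → Set
transport T N φ C ℓ = ∃[ v ] (φ v ≡ ℓ × C v ≡ true)

GalledCompletable : (T : Graph) → (Character T → Set) → Set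
GalledCompletable T 𝒞 =
  Σ Graph λ N → Σ (Fin (m N) → Bool) λ isT → Σ (Fin (n T) → Fin (n N)) λ φ →
    IsLGT N isT × IsGalledTree N (AllE {N}) × BaseTreeIso T N isT φ ×
    (∀ C → 𝒞 C → Explains N isT (transport T N φ C))

LeavesBelowIn : (T : Graph) → Character T → Fin (n T) → Set
LeavesBelowIn T C v = ∀ ℓ → Leaf T (AllE {T}) ℓ → Reach T (AllE {T}) v ℓ → C ℓ ≡ true

IsFA : (T : Graph) → Character T → Fin (n T) → Set
IsFA T C v = LeavesBelowIn T C v ×
  (InDeg0 T (AllE {T}) v ⊎
   ∃[ e ] (tgt T e ≡ v × ¬ LeavesBelowIn T C (src T e)))

-- Call two nodes of N in the same region when some node outside F_C reaches both in the support
-- tree. A transfer edge g joining two regions closes, with support paths, an underlying cycle through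
-- any allowed node above either end of g, and g is the only transfer edge on that cycle. Since N is a
-- galled tree, two such cycles through one node coincide, so an allowed node lies above the ends of at
-- most one such crossing. The node u witnessing that N explains C reaches each leaf of C through allowed
-- nodes, and along such a path the region changes at most once, always through the same crossing; hence
-- of any three leaves of C two share a region. Leaves below two distinct FA nodes never do: an allowed
-- common ancestor lies above an image y of a node of T with all leaves of y in C, and y is an ancestor
-- of both leaves, so the two FA nodes would be comparable, contradicting their maximality.
module Submission where

open import Defs
open import Data.Nat using (ℕ; zero; suc; _≤_; _<_; _+_; _∸_; z≤n; s≤s; s≤s⁻¹; _≤?_; _<?_)
open import Data.Nat.Properties
open import Data.Bool using (Bool; true; false) renaming (_≟_ to _≟B_)
open import Data.Fin using (Fin; toℕ; fromℕ<)
open import Data.Fin.Properties using (any?; all?; toℕ-fromℕ<; toℕ-injective; toℕ<n; injective⇒≤) renaming (_≟_ to _≟F_)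
open import Data.List using (List; length; []; _∷_; filter; allFin)
open import Data.List.Membership.Propositional using (_∈_)
open import Data.List.Membership.Propositional.Properties using (∈-filter⁺; ∈-allFin)
open import Data.List.Relation.Unary.All using (All; []; _∷_)
open import Data.List.Relation.Unary.All.Properties using (all-filter)
open import Data.List.Relation.Unary.AllPairs using ([]; _∷_)
open import Data.List.Relation.Unary.Unique.Propositional using (Unique)
open import Data.List.Relation.Unary.Unique.Propositional.Properties using (filter⁺; allFin⁺)
open import Data.Product
open import Data.Sum
open import Data.Unit using (tt)
open import Data.Empty
open import Function using (case_of_)
open import Relation.Nullary
open import Relation.Nullary.Decidable using (decidable-stable)
open import Relation.Unary using (Decidable)
open import Relation.Binary.PropositionalEquality using (_≡_; _≢_; refl; sym; trans; cong; subst; subst₂; module ≡-Reasoning)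
open import Relation.Binary.Definitions using (tri<; tri≈; tri>)

toℕ-next : ∀ {k} (i : Fin (suc k)) → toℕ (next i) ≡ suc (toℕ i) ⊎ (toℕ (next i) ≡ 0 × suc (toℕ i) ≡ suc k)
toℕ-next {k} i with suc (toℕ i) <? suc k
... | yes i+1<k+1 = inj₁ (toℕ-fromℕ< i+1<k+1)
... | no i+1≮k+1 = inj₂ (refl , ≤-antisym (toℕ<n i) (≮⇒≥ i+1≮k+1))

at-most-two : ∀ {k} {P : Fin k → Set} → Decidable P →
              (∀ x y z → P x → P y → P z → x ≢ y → x ≢ z → y ≢ z → ⊥) →
              ∃[ xs ] (length xs ≤ 2 × (∀ v → P v → v ∈ xs))
at-most-two {k} {P} P? no-three =
  xs , short xs (filter⁺ P? (allFin⁺ k)) (all-filter P? (allFin k)) , λ v Pv → ∈-filter⁺ P? (∈-allFin v) Pv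
  where
    xs : List (Fin k)
    xs = filter P? (allFin k)
    short : ∀ ys → Unique ys → All P ys → length ys ≤ 2
    short [] _ _ = z≤n
    short (_ ∷ []) _ _ = s≤s z≤n
    short (_ ∷ _ ∷ []) _ _ = s≤s (s≤s z≤n)
    short (x ∷ y ∷ z ∷ _) ((x≢y ∷ x≢z ∷ _) ∷ (y≢z ∷ _) ∷ _) (Px ∷ Py ∷ Pz ∷ _) =
      ⊥-elim (no-three x y z Px Py Pz x≢y x≢z y≢z)

module Paths (G : Graph) (E : Fin (m G) → Set) where
  private
    variable
      Q : Fin (n G) → Set
      u v w : Fin (n G)

  infix 4 _⇝_ _∈ₑ_
  infixr 5 _++_

  _⇝_ : Fin (n G) → Fin (n G) → Set
  _⇝_ = Reach G E

  len : Path G E Q u v → ℕ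
  len (stop _)           = 0
  len (step _ _ _ _ π)   = suc (len π)

  -- Positions beyond the end of a path all denote its last node.
  node : Path G E Q u v → ℕ → Fin (n G)
  node {u = u} _ zero = u
  node {u = u} (stop _) (suc i) = u
  node (step _ _ _ _ π) (suc i) = node π i

  edge : Fin (m G) → Path G E Q u v → ℕ → Fin (m G)
  edge d (stop _) _ = d
  edge d (step e _ _ _ π) zero = e
  edge d (step e _ _ _ π) (suc i) = edge d π i

  _∈ₑ_ : Fin (m G) → Path G E Q u v → Set
  e ∈ₑ stop _ = ⊥
  e ∈ₑ step e′ _ _ _ π = e ≡ e′ ⊎ e ∈ₑ π

  ∈ₑ⇒E : ∀ {e} (π : Path G E Q u v) → e ∈ₑ π → E e
  ∈ₑ⇒E (step _ Ee _ _ π) (inj₁ refl) = Ee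
  ∈ₑ⇒E (step _ _ _ _ π) (inj₂ p) = ∈ₑ⇒E π p

  ∈ₑ⇒len>0 : ∀ {e} (π : Path G E Q u v) → e ∈ₑ π → 0 < len π
  ∈ₑ⇒len>0 (step _ _ _ _ _) _ = s≤s z≤n

  node-end : (π : Path G E Q u v) → ∀ i → len π ≤ i → node π i ≡ v
  node-end (stop _) zero _ = refl
  node-end (stop _) (suc i) _ = refl
  node-end (step _ _ _ _ π) (suc i) (s≤s p) = node-end π i p

  node-Q : (π : Path G E Q u v) → ∀ i → Q (node π i)
  node-Q (stop q) zero = q
  node-Q (stop q) (suc i) = q
  node-Q (step _ _ _ q π) zero = q
  node-Q (step _ _ _ _ π) (suc i) = node-Q π i

  edge-spec : ∀ d (π : Path G E Q u v) i → i < len π →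
              E (edge d π i) × src G (edge d π i) ≡ node π i × tgt G (edge d π i) ≡ node π (suc i)
  edge-spec d (step e Ee se _ π) zero _ = Ee , se , refl
  edge-spec d (step e Ee se _ π) (suc i) (s≤s p) = edge-spec d π i p

  edge-∈ₑ : ∀ d (π : Path G E Q u v) i → i < len π → edge d π i ∈ₑ π
  edge-∈ₑ d (step e _ _ _ π) zero _ = inj₁ refl
  edge-∈ₑ d (step e _ _ _ π) (suc i) (s≤s p) = inj₂ (edge-∈ₑ d π i p)

  ∈ₑ⇒edge : ∀ d (π : Path G E Q u v) e → e ∈ₑ π → ∃ λ i → i < len π × edge d π i ≡ e
  ∈ₑ⇒edge d (step e′ _ _ _ π) e (inj₁ refl) = 0 , s≤s z≤n , refl
  ∈ₑ⇒edge d (step e′ _ _ _ π) e (inj₂ p) =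
    let i , i<len , eq = ∈ₑ⇒edge d π e p in suc i , s≤s i<len , eq

  edgeAt : (π : Path G E Q u v) → ∀ i → i < len π →
           ∃ λ e → E e × src G e ≡ node π i × tgt G e ≡ node π (suc i)
  edgeAt π@(step e _ _ _ _) i i<len = edge e π i , edge-spec e π i i<len

  _++_ : Path G E Q u v → Path G E Q v w → Path G E Q u w
  stop _ ++ τ = τ
  step e Ee se q π ++ τ = step e Ee se q (π ++ τ)

  len-++ : (σ : Path G E Q u v) (τ : Path G E Q v w) → len (σ ++ τ) ≡ len σ + len τ
  len-++ (stop _) τ = refl
  len-++ (step _ _ _ _ σ) τ = cong suc (len-++ σ τ)

  node-++ˡ : (σ : Path G E Q u v) (τ : Path G E Q v w) → ∀ i → i ≤ len σ → node (σ ++ τ) i ≡ node σ i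
  node-++ˡ σ τ zero _ = refl
  node-++ˡ (step _ _ _ _ σ) τ (suc i) (s≤s p) = node-++ˡ σ τ i p

  node-++ʳ : (σ : Path G E Q u v) (τ : Path G E Q v w) → ∀ j → node (σ ++ τ) (len σ + j) ≡ node τ j
  node-++ʳ (stop _) τ j = refl
  node-++ʳ (step _ _ _ _ σ) τ j = node-++ʳ σ τ j

  ∈ₑ-++⁻ : ∀ {e} (σ : Path G E Q u v) (τ : Path G E Q v w) → e ∈ₑ σ ++ τ → e ∈ₑ σ ⊎ e ∈ₑ τ
  ∈ₑ-++⁻ (stop _) τ p = inj₂ p
  ∈ₑ-++⁻ (step _ _ _ _ σ) τ (inj₁ q) = inj₁ (inj₁ q)
  ∈ₑ-++⁻ (step _ _ _ _ σ) τ (inj₂ p) = Data.Sum.map₁ inj₂ (∈ₑ-++⁻ σ τ p)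

  ∈ₑ-++⁺ʳ : ∀ {e} (σ : Path G E Q u v) (τ : Path G E Q v w) → e ∈ₑ τ → e ∈ₑ σ ++ τ
  ∈ₑ-++⁺ʳ (stop _) τ p = p
  ∈ₑ-++⁺ʳ (step _ _ _ _ σ) τ p = inj₂ (∈ₑ-++⁺ʳ σ τ p)

  single : ∀ e → E e → src G e ≡ u → tgt G e ≡ v → u ⇝ v
  single e Ee refl refl = step e Ee refl tt (stop tt)

  len-single : ∀ e (Ee : E e) (se : src G e ≡ u) (te : tgt G e ≡ v) → len (single e Ee se te) ≡ 1
  len-single e Ee refl refl = refl

  ∈ₑ-single : ∀ {f} e (Ee : E e) (se : src G e ≡ u) (te : tgt G e ≡ v) → f ∈ₑ single e Ee se te → f ≡ e
  ∈ₑ-single e Ee refl refl (inj₁ f≡e) = f≡e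

  len-++-single : ∀ (σ : u ⇝ v) e (Ee : E e) (se : src G e ≡ v) (te : tgt G e ≡ w) →
                  len (σ ++ single e Ee se te) ≡ suc (len σ)
  len-++-single σ e Ee se te = begin
    len (σ ++ single e Ee se te)    ≡⟨ len-++ σ _ ⟩
    len σ + len (single e Ee se te) ≡⟨ cong (len σ +_) (len-single e Ee se te) ⟩
    len σ + 1                       ≡⟨ +-comm (len σ) 1 ⟩
    suc (len σ)                     ∎
    where open ≡-Reasoning

  subpath : (π : Path G E Q u v) → ∀ i j → i ≤ j → node π i ⇝ node π j
  subpath π zero zero _ = stop tt
  subpath (stop _) zero (suc j) _ = stop tt
  subpath (step e Ee se _ π) zero (suc j) _ = step e Ee se tt (subpath π zero j z≤n)
  subpath (stop _) (suc i) (suc j) _ = stop tt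
  subpath (step _ _ _ _ π) (suc i) (suc j) (s≤s p) = subpath π i j p

  node⇝end : (π : Path G E Q u v) → ∀ j → node π j ⇝ v
  node⇝end π j = subst (node π j ⇝_) (node-end π (j + len π) (m≤n+m (len π) j))
                   (subpath π j (j + len π) (m≤m+n j (len π)))

  start⇝node : (π : Path G E Q u v) → ∀ j → u ⇝ node π j
  start⇝node π j = subpath π 0 j z≤n

  lastVisit : (D : Fin (n G) → Set) → (∀ x → Dec (D x)) → (π : u ⇝ v) →
              (∀ i → ¬ D (node π i)) ⊎
              (∃ λ x → D x × Σ (x ⇝ v) λ σ → ∀ i → 0 < i → i ≤ len σ → ¬ D (node σ i))
  lastVisit {u = u} D D? (stop _) with D? u
  ... | yes d = inj₂ (u , d , stop tt , λ { (suc i) _ () })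
  ... | no ¬d = inj₁ λ { zero → ¬d ; (suc i) → ¬d }
  lastVisit {u = u} D D? (step e Ee se _ π) with lastVisit D D? π
  ... | inj₂ r = inj₂ r
  ... | inj₁ none with D? u
  ...   | yes d = inj₂ (u , d , step e Ee se tt π , λ { (suc i) _ _ → none i })
  ...   | no ¬d = inj₁ λ { zero → ¬d ; (suc i) → none i }

  node-within : (π : Path G E Q u v) → ∀ i → ∃ λ j → j ≤ len π × node π j ≡ node π i
  node-within π i with i ≤? len π
  ... | yes i≤len = i , i≤len , refl
  ... | no i≰len = len π , ≤-refl , trans (node-end π (len π) ≤-refl) (sym (node-end π i (<⇒≤ (≰⇒> i≰len))))

  ++-avoids : (D : Fin (n G) → Set) (σ : u ⇝ v) (τ : v ⇝ w) →
              (∀ i → 0 < i → i ≤ len σ → ¬ D (node σ i)) → (∀ j → ¬ D (node τ j)) →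
              ∀ i → 0 < i → ¬ D (node (σ ++ τ) i)
  ++-avoids D σ τ avoidσ avoidτ i i>0 with i ≤? len σ
  ... | yes i≤ = subst (λ x → ¬ D x) (sym (node-++ˡ σ τ i i≤)) (avoidσ i i>0 i≤)
  ... | no i≰ = subst (λ x → ¬ D x) (sym eq) (avoidτ (i ∸ len σ))
    where
      eq : node (σ ++ τ) i ≡ node τ (i ∸ len σ)
      eq = begin
        node (σ ++ τ) i                      ≡⟨ cong (node (σ ++ τ)) (sym (m+[n∸m]≡n (<⇒≤ (≰⇒> i≰)))) ⟩
        node (σ ++ τ) (len σ + (i ∸ len σ))  ≡⟨ node-++ʳ σ τ (i ∸ len σ) ⟩
        node τ (i ∸ len σ)                   ∎
        where open ≡-Reasoning

module Weaken (G : Graph) {E E′ : Fin (m G) → Set} (E⊆E′ : ∀ e → E e → E′ e) where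
  open Paths G E
  private
    module P′ = Paths G E′
    variable
      Q : Fin (n G) → Set
      u v : Fin (n G)

  weaken : Path G E Q u v → Path G E′ Q u v
  weaken (stop q) = stop q
  weaken (step e Ee se q π) = step e (E⊆E′ e Ee) se q (weaken π)

  len-weaken : (π : Path G E Q u v) → P′.len (weaken π) ≡ len π
  len-weaken (stop _) = refl
  len-weaken (step _ _ _ _ π) = cong suc (len-weaken π)

  node-weaken : (π : Path G E Q u v) → ∀ i → P′.node (weaken π) i ≡ node π i
  node-weaken π zero = refl
  node-weaken (stop _) (suc i) = refl
  node-weaken (step _ _ _ _ π) (suc i) = node-weaken π i

  ∈ₑ-weaken⁻ : ∀ {e} (π : Path G E Q u v) → e P′.∈ₑ weaken π → e ∈ₑ π
  ∈ₑ-weaken⁻ (step _ _ _ _ π) (inj₁ q) = inj₁ q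
  ∈ₑ-weaken⁻ (step _ _ _ _ π) (inj₂ p) = inj₂ (∈ₑ-weaken⁻ π p)

module Acyclic (G : Graph) (E : Fin (m G) → Set) (acyclic : ∀ e → E e → ¬ Reach G E (tgt G e) (src G e)) where
  open Paths G E
  private
    variable
      Q : Fin (n G) → Set
      u v : Fin (n G)

  node-distinct : (π : Path G E Q u v) → ∀ i j → i < j → j ≤ len π → node π i ≢ node π j
  node-distinct π i j i<j j≤len eq with edgeAt π i (<-≤-trans i<j j≤len)
  ... | e , Ee , se , te = acyclic e Ee (subst₂ _⇝_ (sym te) (trans (sym eq) (sym se)) (subpath π (suc i) j i<j))

  node-injective : (π : Path G E Q u v) → ∀ i j → i ≤ len π → j ≤ len π → node π i ≡ node π j → i ≡ j
  node-injective π i j i≤ j≤ eq with <-cmp i j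
  ... | tri< i<j _ _ = ⊥-elim (node-distinct π i j i<j j≤ eq)
  ... | tri≈ _ i≡j _ = i≡j
  ... | tri> _ _ j<i = ⊥-elim (node-distinct π j i j<i i≤ (sym eq))

  edge-injective : ∀ d (π : Path G E Q u v) i j → i < len π → j < len π → edge d π i ≡ edge d π j → i ≡ j
  edge-injective d π i j i<len j<len eq =
    node-injective π i j (<⇒≤ i<len) (<⇒≤ j<len)
      (trans (sym (proj₁ (proj₂ (edge-spec d π i i<len))))
        (trans (cong (src G) eq) (proj₁ (proj₂ (edge-spec d π j j<len)))))

  len<n : (π : Path G E Q u v) → len π < n G
  len<n π = injective⇒≤ {f = λ i → node π (toℕ i)} λ {i} {j} eq →
    toℕ-injective (node-injective π (toℕ i) (toℕ j) (s≤s⁻¹ (toℕ<n i)) (s≤s⁻¹ (toℕ<n j)) eq)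

  len>0⇒ends-distinct : (π : Path G E Q u v) → 0 < len π → u ≢ v
  len>0⇒ends-distinct π len>0 eq = node-distinct π 0 (len π) len>0 ≤-refl (trans eq (sym (node-end π (len π) ≤-refl)))

  ends-distinct⇒len>0 : (π : Path G E Q u v) → u ≢ v → 0 < len π
  ends-distinct⇒len>0 (stop _) u≢u = ⊥-elim (u≢u refl)
  ends-distinct⇒len>0 (step _ _ _ _ π) _ = s≤s z≤n

  module Decide (E? : ∀ e → Dec (E e)) where
    private
      ReachWithin : ℕ → Fin (n G) → Fin (n G) → Set
      ReachWithin k u v = Σ (u ⇝ v) λ π → len π ≤ k

      reachWithin? : ∀ k u v → Dec (ReachWithin k u v)
      reachWithin? k u v with u ≟F v
      ... | yes refl = yes (stop tt , z≤n)
      reachWithin? zero u v | no u≢v = no λ { (stop _ , _) → u≢v refl ; (step _ _ _ _ _ , ()) }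
      reachWithin? (suc k) u v | no u≢v
        with any? (λ e → E? e ×-dec ((src G e ≟F u) ×-dec reachWithin? k (tgt G e) v))
      ... | yes (e , Ee , se , π , l) = yes (step e Ee se tt π , s≤s l)
      ... | no ∄ = no λ { (stop _ , _) → u≢v refl ; (step e Ee se _ π , s≤s l) → ∄ (e , Ee , se , π , l) }

    _⇝?_ : ∀ u v → Dec (u ⇝ v)
    u ⇝? v with reachWithin? (n G) u v
    ... | yes (π , _) = yes π
    ... | no ∄ = no λ π → ∄ (π , <⇒≤ (len<n π))

module DecidableDegrees (G : Graph) {E : Fin (m G) → Set} (E? : ∀ e → Dec (E e)) where
  inDeg0? : ∀ v → Dec (InDeg0 G E v)
  inDeg0? v = all? (λ e → E? e →-dec ¬? (tgt G e ≟F v))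

  outDeg0? : ∀ v → Dec (OutDeg0 G E v)
  outDeg0? v = all? (λ e → E? e →-dec ¬? (src G e ≟F v))

  inDeg1? : ∀ v → Dec (InDeg1 G E v)
  inDeg1? v = any? (λ e → E? e ×-dec (tgt G e ≟F v) ×-dec
                all? (λ e′ → E? e′ →-dec ((tgt G e′ ≟F v) →-dec (e′ ≟F e))))

  outDeg1? : ∀ v → Dec (OutDeg1 G E v)
  outDeg1? v = any? (λ e → E? e ×-dec (src G e ≟F v) ×-dec
                 all? (λ e′ → E? e′ →-dec ((src G e′ ≟F v) →-dec (e′ ≟F e))))

  subdiv? : ∀ v → Dec (Subdiv G E v)
  subdiv? v = inDeg1? v ×-dec outDeg1? v

  leaf? : ∀ v → Dec (Leaf G E v)
  leaf? v = inDeg1? v ×-dec outDeg0? v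

module Network (G : Graph) {E : Fin (m G) → Set} (E? : ∀ e → Dec (E e)) (net : IsNetwork G E) where
  open Paths G E
  open Acyclic G E (proj₁ net) public
  open Decide E? public

  -- Paths are shorter than n G, so neither walk below can go on for n G steps.
  private
    backwards : ∀ k v → (∃ λ r → InDeg0 G E r × r ⇝ v) ⊎ (∃ λ u → Σ (u ⇝ v) λ π → len π ≡ k)
    backwards zero v = inj₂ (v , stop tt , refl)
    backwards (suc k) v with backwards k v
    ... | inj₁ found = inj₁ found
    ... | inj₂ (u , π , l) with any? (λ e → E? e ×-dec (tgt G e ≟F u))
    ...   | yes (e , Ee , refl) = inj₂ (src G e , step e Ee refl tt π , cong suc l)
    ...   | no ∄ = inj₁ (u , (λ e Ee te → ∄ (e , Ee , te)) , π)

    forwards : ∀ k v → (∃ λ ℓ → OutDeg0 G E ℓ × v ⇝ ℓ) ⊎ (∃ λ u → Σ (v ⇝ u) λ π → len π ≡ k)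
    forwards zero v = inj₂ (v , stop tt , refl)
    forwards (suc k) v with any? (λ e → E? e ×-dec (src G e ≟F v))
    ... | no ∄ = inj₁ (v , (λ e Ee se → ∄ (e , Ee , se)) , stop tt)
    ... | yes (e , Ee , se) with forwards k (tgt G e)
    ...   | inj₁ (ℓ , out0 , π) = inj₁ (ℓ , out0 , step e Ee se tt π)
    ...   | inj₂ (u , π , l) = inj₂ (u , step e Ee se tt π , cong suc l)

  root : Fin (n G)
  root = proj₁ (proj₂ net)

  root⇝ : ∀ v → root ⇝ v
  root⇝ v with backwards (n G) v
  ... | inj₁ (r , in0 , π) = subst (_⇝ v) (proj₂ (proj₂ (proj₂ net)) r in0) π
  ... | inj₂ (u , π , l) = ⊥-elim (<-irrefl l (len<n π))

  ⇝sink : ∀ v → ∃ λ ℓ → OutDeg0 G E ℓ × v ⇝ ℓ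
  ⇝sink v with forwards (n G) v
  ... | inj₁ found = found
  ... | inj₂ (u , π , l) = ⊥-elim (<-irrefl l (len<n π))

module CycleOfPaths (G : Graph) (E : Fin (m G) → Set) (acyclic : ∀ e → E e → ¬ Reach G E (tgt G e) (src G e)) where
  open Paths G E
  open Acyclic G E acyclic

  record PathCycle {w v : Fin (n G)} (P Q : w ⇝ v) : Set where
    field
      cycle   : Cycle G E
      P-nodes : ∀ i → NodeOn G E (node P i) cycle
      Q-nodes : ∀ j → NodeOn G E (node Q j) cycle
      P-edges : ∀ e → e ∈ₑ P → EdgeOn G E e cycle
      edges   : ∀ e → EdgeOn G E e cycle → e ∈ₑ P ⊎ e ∈ₑ Q

  module _ {w v} (P Q : w ⇝ v) (w≢v : w ≢ v)
    (disjoint : ∀ i j → 0 < i → i < len P → 0 < j → j < len Q → node P i ≢ node Q j)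
    (not-same-edge : ∀ e → len P ≡ 1 → len Q ≡ 1 → e ∈ₑ P → e ∈ₑ Q → ⊥) where

    private
      a b s : ℕ
      a = len P
      b = len Q
      s = a + b

      a>0 : 0 < a
      a>0 = ends-distinct⇒len>0 P w≢v

      b>0 : 0 < b
      b>0 = ends-distinct⇒len>0 Q w≢v

      d : Fin (m G)
      d = proj₁ (edgeAt P 0 a>0)

      P-end : node P a ≡ v
      P-end = node-end P a ≤-refl

      Q-end : node Q b ≡ v
      Q-end = node-end Q b ≤-refl

      s∸a≡b : s ∸ a ≡ b
      s∸a≡b = m+n∸m≡n a b

      meet : ∀ i t → i ≤ a → t ≤ b → node P i ≡ node Q t → (i ≡ 0 × t ≡ 0) ⊎ (i ≡ a × t ≡ b)
      meet zero t _ t≤b eq = inj₁ (refl , node-injective Q t 0 t≤b z≤n (sym eq))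
      meet (suc i) zero i≤a _ eq = ⊥-elim (1+n≢0 (node-injective P (suc i) 0 i≤a z≤n eq))
      meet (suc i) (suc t) i≤a t≤b eq with m≤n⇒m<n∨m≡n i≤a | m≤n⇒m<n∨m≡n t≤b
      ... | inj₂ i≡a | inj₂ t≡b = inj₂ (i≡a , t≡b)
      ... | inj₂ i≡a | inj₁ t<b =
        ⊥-elim (<-irrefl (node-injective Q (suc t) b t≤b ≤-refl
          (trans (sym eq) (trans (cong (node P) i≡a) (trans P-end (sym Q-end))))) t<b)
      ... | inj₁ i<a | inj₂ t≡b =
        ⊥-elim (<-irrefl (node-injective P (suc i) a i≤a ≤-refl
          (trans eq (trans (cong (node Q) t≡b) (trans Q-end (sym P-end))))) i<a)
      ... | inj₁ i<a | inj₁ t<b = ⊥-elim (disjoint (suc i) (suc t) (s≤s z≤n) i<a (s≤s z≤n) t<b eq)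

      -- The cycle runs along P from w to v and then back along Q: position i ≥ a is node s ∸ i of Q.
      cycleNode : ℕ → Fin (n G)
      cycleNode i with i <? a
      ... | yes _ = node P i
      ... | no _  = node Q (s ∸ i)

      cycleEdge : ℕ → Fin (m G)
      cycleEdge i with i <? a
      ... | yes _ = edge d P i
      ... | no _  = edge d Q (s ∸ suc i)

      cycleNode-P : ∀ {i} → i < a → cycleNode i ≡ node P i
      cycleNode-P {i} i<a with i <? a
      ... | yes _ = refl
      ... | no i≮a = ⊥-elim (i≮a i<a)

      cycleNode-Q : ∀ {i} → a ≤ i → cycleNode i ≡ node Q (s ∸ i)
      cycleNode-Q {i} a≤i with i <? a
      ... | yes i<a = ⊥-elim (<-irrefl refl (≤-<-trans a≤i i<a))
      ... | no _ = refl

      cycleEdge-P : ∀ {i} → i < a → cycleEdge i ≡ edge d P i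
      cycleEdge-P {i} i<a with i <? a
      ... | yes _ = refl
      ... | no i≮a = ⊥-elim (i≮a i<a)

      cycleEdge-Q : ∀ {i} → a ≤ i → cycleEdge i ≡ edge d Q (s ∸ suc i)
      cycleEdge-Q {i} a≤i with i <? a
      ... | yes i<a = ⊥-elim (<-irrefl refl (≤-<-trans a≤i i<a))
      ... | no _ = refl

      cycleNode-P≤ : ∀ {i} → i ≤ a → cycleNode i ≡ node P i
      cycleNode-P≤ {i} i≤a with m≤n⇒m<n∨m≡n i≤a
      ... | inj₁ i<a = cycleNode-P i<a
      ... | inj₂ refl = trans (cycleNode-Q ≤-refl) (trans (cong (node Q) s∸a≡b) (trans Q-end (sym P-end)))

      cycleNode-s : cycleNode s ≡ cycleNode 0
      cycleNode-s = trans (cycleNode-Q (m≤m+n a b)) (trans (cong (node Q) (n∸n≡0 s)) (sym (cycleNode-P a>0)))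

      Q-index< : ∀ {i} → a ≤ i → i < s → s ∸ suc i < b
      Q-index< {i} a≤i i<s = subst (s ∸ suc i <_) s∸a≡b (∸-monoʳ-< (s≤s a≤i) i<s)

      Q-index≤ : ∀ {i} → a ≤ i → s ∸ i ≤ b
      Q-index≤ {i} a≤i = subst (s ∸ i ≤_) s∸a≡b (∸-monoʳ-≤ s a≤i)

      s∸i≡1+s∸1+i : ∀ {i} → i < s → s ∸ i ≡ suc (s ∸ suc i)
      s∸i≡1+s∸1+i i<s = +-∸-assoc 1 i<s

      join : ∀ i → i < s → joins G E (cycleEdge i) (cycleNode i) (cycleNode (suc i))
      join i i<s with <-≤-connex i a
      ... | inj₁ i<a =
        let _ , se , te = edge-spec d P i i<a in
        subst₂ (λ e x → joins G E e x (cycleNode (suc i))) (sym (cycleEdge-P i<a)) (sym (cycleNode-P i<a))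
          (inj₁ (se , trans te (sym (cycleNode-P≤ i<a))))
      ... | inj₂ a≤i =
        let _ , se , te = edge-spec d Q (s ∸ suc i) (Q-index< a≤i i<s) in
        subst₂ (λ e x → joins G E e x (cycleNode (suc i))) (sym (cycleEdge-Q a≤i)) (sym (cycleNode-Q a≤i))
          (inj₂ (trans se (sym (cycleNode-Q (≤-trans a≤i (n≤1+n i)))) ,
                 trans te (cong (node Q) (sym (s∸i≡1+s∸1+i i<s)))))

      cycleEdge-E : ∀ i → i < s → E (cycleEdge i)
      cycleEdge-E i i<s with <-≤-connex i a
      ... | inj₁ i<a = subst E (sym (cycleEdge-P i<a)) (proj₁ (edge-spec d P i i<a))
      ... | inj₂ a≤i = subst E (sym (cycleEdge-Q a≤i)) (proj₁ (edge-spec d Q (s ∸ suc i) (Q-index< a≤i i<s)))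

      P≢Q-node : ∀ i j → i < a → a ≤ j → j < s → node P i ≢ node Q (s ∸ j)
      P≢Q-node i j i<a a≤j j<s eq with meet i (s ∸ j) (<⇒≤ i<a) (Q-index≤ a≤j) eq
      ... | inj₁ (_ , s∸j≡0) = <-irrefl (sym s∸j≡0) (m<n⇒0<n∸m j<s)
      ... | inj₂ (i≡a , _) = <-irrefl i≡a i<a

      cycleNode-injective : ∀ i j → i < s → j < s → cycleNode i ≡ cycleNode j → i ≡ j
      cycleNode-injective i j i<s j<s eq with <-≤-connex i a | <-≤-connex j a
      ... | inj₁ i<a | inj₁ j<a =
        node-injective P i j (<⇒≤ i<a) (<⇒≤ j<a) (trans (sym (cycleNode-P i<a)) (trans eq (cycleNode-P j<a)))
      ... | inj₁ i<a | inj₂ a≤j =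
        ⊥-elim (P≢Q-node i j i<a a≤j j<s (trans (sym (cycleNode-P i<a)) (trans eq (cycleNode-Q a≤j))))
      ... | inj₂ a≤i | inj₁ j<a =
        ⊥-elim (P≢Q-node j i j<a a≤i i<s (trans (sym (cycleNode-P j<a)) (trans (sym eq) (cycleNode-Q a≤i))))
      ... | inj₂ a≤i | inj₂ a≤j =
        ∸-cancelˡ-≡ (<⇒≤ i<s) (<⇒≤ j<s)
          (node-injective Q (s ∸ i) (s ∸ j) (Q-index≤ a≤i) (Q-index≤ a≤j)
            (trans (sym (cycleNode-Q a≤i)) (trans eq (cycleNode-Q a≤j))))

      -- A common edge would have to leave w on both paths and enter v on both.
      P≢Q-edge : ∀ i t → i < a → t < b → edge d P i ≢ edge d Q t
      P≢Q-edge i t i<a t<b eq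
        with edge-spec d P i i<a | edge-spec d Q t t<b
      ... | _ , se , te | _ , se′ , te′
        with meet i t (<⇒≤ i<a) (<⇒≤ t<b) (trans (sym se) (trans (cong (src G) eq) se′))
      ... | inj₂ (i≡a , _) = <-irrefl i≡a i<a
      ... | inj₁ (refl , refl)
        with meet 1 1 a>0 b>0 (trans (sym te) (trans (cong (tgt G) eq) te′))
      ... | inj₁ (() , _)
      ... | inj₂ (1≡a , 1≡b) =
        not-same-edge (edge d P 0) (sym 1≡a) (sym 1≡b) (edge-∈ₑ d P 0 a>0)
          (subst (_∈ₑ Q) (sym eq) (edge-∈ₑ d Q 0 b>0))

      cycleEdge-injective : ∀ i j → i < s → j < s → cycleEdge i ≡ cycleEdge j → i ≡ j
      cycleEdge-injective i j i<s j<s eq with <-≤-connex i a | <-≤-connex j a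
      ... | inj₁ i<a | inj₁ j<a =
        edge-injective d P i j i<a j<a (trans (sym (cycleEdge-P i<a)) (trans eq (cycleEdge-P j<a)))
      ... | inj₁ i<a | inj₂ a≤j =
        ⊥-elim (P≢Q-edge i _ i<a (Q-index< a≤j j<s) (trans (sym (cycleEdge-P i<a)) (trans eq (cycleEdge-Q a≤j))))
      ... | inj₂ a≤i | inj₁ j<a =
        ⊥-elim (P≢Q-edge j _ j<a (Q-index< a≤i i<s) (trans (sym (cycleEdge-P j<a)) (trans (sym eq) (cycleEdge-Q a≤i))))
      ... | inj₂ a≤i | inj₂ a≤j =
        suc-injective (∸-cancelˡ-≡ i<s j<s
          (edge-injective d Q (s ∸ suc i) (s ∸ suc j) (Q-index< a≤i i<s) (Q-index< a≤j j<s)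
            (trans (sym (cycleEdge-Q a≤i)) (trans eq (cycleEdge-Q a≤j)))))

      k : ℕ
      k = s ∸ 2

      2+k≡s : suc (suc k) ≡ s
      2+k≡s = m+[n∸m]≡n (+-mono-≤ a>0 b>0)

      position : ∀ i → i < s → Fin (suc (suc k))
      position i i<s = fromℕ< (subst (i <_) (sym 2+k≡s) i<s)

      toℕ-position : ∀ i (i<s : i < s) → toℕ (position i i<s) ≡ i
      toℕ-position i i<s = toℕ-fromℕ< _

      toℕ<s : (i : Fin (suc (suc k))) → toℕ i < s
      toℕ<s i = subst (toℕ i <_) 2+k≡s (toℕ<n i)

      cycleNode-next : (i : Fin (suc (suc k))) → cycleNode (toℕ (next i)) ≡ cycleNode (suc (toℕ i))
      cycleNode-next i with toℕ-next i
      ... | inj₁ eq = cong cycleNode eq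
      ... | inj₂ (eq , wraps) =
        trans (cong cycleNode eq) (trans (sym cycleNode-s) (cong cycleNode (sym (trans wraps 2+k≡s))))

      cyc : Cycle G E
      cyc = record
        { k = k
        ; vs = λ i → cycleNode (toℕ i)
        ; es = λ i → cycleEdge (toℕ i)
        ; vs-inj = λ {i} {j} eq → toℕ-injective (cycleNode-injective (toℕ i) (toℕ j) (toℕ<s i) (toℕ<s j) eq)
        ; es-inj = λ {i} {j} eq → toℕ-injective (cycleEdge-injective (toℕ i) (toℕ j) (toℕ<s i) (toℕ<s j) eq)
        ; es-E = λ i → cycleEdge-E (toℕ i) (toℕ<s i)
        ; es-join = λ i → subst (joins G E (cycleEdge (toℕ i)) (cycleNode (toℕ i))) (sym (cycleNode-next i))
                                (join (toℕ i) (toℕ<s i))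
        }

      at : ∀ i → i < s → NodeOn G E (cycleNode i) cyc
      at i i<s = position i i<s , cong cycleNode (toℕ-position i i<s)

      P-nodes : ∀ i → NodeOn G E (node P i) cyc
      P-nodes i =
        let j , j≤a , eq = node-within P i
            on = at j (≤-<-trans j≤a (m<m+n a b>0)) in
        proj₁ on , trans (proj₂ on) (trans (cycleNode-P≤ j≤a) eq)

      Q-nodes : ∀ j → NodeOn G E (node Q j) cyc
      Q-nodes j with node-within Q j
      ... | zero , _ , eq = subst (λ x → NodeOn G E x cyc) eq (P-nodes 0)
      ... | suc t , t<b , eq =
        let on = at (s ∸ suc t) (∸-monoʳ-< {o = 0} (s≤s z≤n) (≤-trans t<b (m≤n+m b a)))
            a≤ = subst (_≤ s ∸ suc t) (m+n∸n≡m a b) (∸-monoʳ-≤ s t<b) in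
        proj₁ on ,
        trans (proj₂ on) (trans (cycleNode-Q a≤) (trans (cong (node Q) (m∸[m∸n]≡n (≤-trans t<b (m≤n+m b a)))) eq))

      P-edges : ∀ e → e ∈ₑ P → EdgeOn G E e cyc
      P-edges e e∈P =
        let i , i<a , eq = ∈ₑ⇒edge d P e e∈P
            i<s = <-≤-trans i<a (m≤m+n a b) in
        position i i<s , trans (cong cycleEdge (toℕ-position i i<s)) (trans (cycleEdge-P i<a) eq)

      edges : ∀ e → EdgeOn G E e cyc → e ∈ₑ P ⊎ e ∈ₑ Q
      edges e (i , eq) with <-≤-connex (toℕ i) a
      ... | inj₁ i<a = inj₁ (subst (_∈ₑ P) (trans (sym (cycleEdge-P i<a)) eq) (edge-∈ₑ d P (toℕ i) i<a))
      ... | inj₂ a≤i = inj₂ (subst (_∈ₑ Q) (trans (sym (cycleEdge-Q a≤i)) eq)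
                                  (edge-∈ₑ d Q _ (Q-index< a≤i (toℕ<s i))))

    pathCycle : PathCycle P Q
    pathCycle = record { cycle = cyc ; P-nodes = P-nodes ; Q-nodes = Q-nodes ; P-edges = P-edges ; edges = edges }

module Tree (G : Graph) {E : Fin (m G) → Set} (E? : ∀ e → Dec (E e)) (tree : IsTree G E) where
  open Paths G E
  open Network G E? (proj₁ tree) public
  open CycleOfPaths G E (proj₁ (proj₁ tree))

  -- Two edges into one node close an underlying cycle with paths from a last common ancestor of their sources.
  in-edge-unique : ∀ e e′ → E e → E e′ → tgt G e ≡ tgt G e′ → e ≡ e′
  in-edge-unique e e′ Ee Ee′ same-tgt with e ≟F e′ | lastVisit (_⇝ src G e′) (_⇝? src G e′) (root⇝ (src G e))
  ... | yes e≡e′ | _ = e≡e′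
  ... | no _ | inj₁ none = ⊥-elim (none 0 (root⇝ (src G e′)))
  ... | no e≢e′ | inj₂ (w , ρ , σ , σ-avoids) =
    ⊥-elim (proj₂ tree (PathCycle.cycle (pathCycle P Q w≢v disjoint not-same-edge)))
    where
      P Q : w ⇝ tgt G e
      P = σ ++ single e Ee refl refl
      Q = ρ ++ single e′ Ee′ refl (sym same-tgt)
      |P| : len P ≡ suc (len σ)
      |P| = len-++-single σ e Ee refl refl
      |Q| : len Q ≡ suc (len ρ)
      |Q| = len-++-single ρ e′ Ee′ refl (sym same-tgt)
      w≢v : w ≢ tgt G e
      w≢v = len>0⇒ends-distinct P (subst (0 <_) (sym |P|) (s≤s z≤n))
      disjoint : ∀ i j → 0 < i → i < len P → 0 < j → j < len Q → node P i ≢ node Q j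
      disjoint i j i>0 i<|P| _ j<|Q| eq =
        let i≤|σ| = s≤s⁻¹ (subst (i <_) |P| i<|P|)
            j≤|ρ| = s≤s⁻¹ (subst (j <_) |Q| j<|Q|) in
        σ-avoids i i>0 i≤|σ|
          (subst (_⇝ src G e′) (trans (sym (node-++ˡ ρ _ j j≤|ρ|)) (trans (sym eq) (node-++ˡ σ _ i i≤|σ|)))
            (node⇝end ρ j))
      not-same-edge : ∀ f → len P ≡ 1 → len Q ≡ 1 → f ∈ₑ P → f ∈ₑ Q → ⊥
      not-same-edge f |P|≡1 |Q|≡1 f∈P f∈Q with ∈ₑ-++⁻ σ _ f∈P | ∈ₑ-++⁻ ρ _ f∈Q
      ... | inj₁ f∈σ | _ = <-irrefl (sym (suc-injective (trans (sym |P|) |P|≡1))) (∈ₑ⇒len>0 σ f∈σ)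
      ... | inj₂ _ | inj₁ f∈ρ = <-irrefl (sym (suc-injective (trans (sym |Q|) |Q|≡1))) (∈ₑ⇒len>0 ρ f∈ρ)
      ... | inj₂ f≡e | inj₂ f≡e′ =
        e≢e′ (trans (sym (∈ₑ-single e Ee refl refl f≡e)) (∈ₑ-single e′ Ee′ refl (sym same-tgt) f≡e′))

  last-edge : ∀ {x y} (π : x ⇝ y) →
              (x ≡ y × len π ≡ 0) ⊎ (∃ λ e → E e × tgt G e ≡ y × Σ (x ⇝ src G e) λ ρ → suc (len ρ) ≡ len π)
  last-edge (stop _) = inj₁ (refl , refl)
  last-edge (step e Ee refl _ π) with last-edge π
  ... | inj₁ (refl , |π|≡0) = inj₂ (e , Ee , refl , stop tt , cong suc (sym |π|≡0))
  ... | inj₂ (e′ , Ee′ , te′ , ρ , |ρ|+1≡|π|) = inj₂ (e′ , Ee′ , te′ , step e Ee refl tt ρ , cong suc |ρ|+1≡|π|)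

  ancestors-comparable : ∀ {x y ℓ} → x ⇝ ℓ → y ⇝ ℓ → x ⇝ y ⊎ y ⇝ x
  ancestors-comparable π = go (suc (len π)) π ≤-refl
    where
      go : ∀ k {x y ℓ} (π : x ⇝ ℓ) → len π < k → y ⇝ ℓ → x ⇝ y ⊎ y ⇝ x
      go (suc k) π |π|<k π′ with last-edge π | last-edge π′
      ... | inj₁ (refl , _) | _ = inj₂ π′
      ... | inj₂ _ | inj₁ (refl , _) = inj₁ π
      ... | inj₂ (e , Ee , te , ρ , |ρ|+1≡|π|) | inj₂ (e′ , Ee′ , te′ , ρ′ , _)
        with refl ← in-edge-unique e e′ Ee Ee′ (trans te (sym te′)) =
        go k ρ (s≤s⁻¹ (subst (_< suc k) (sym |ρ|+1≡|π|) |π|<k)) ρ′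

module Regions (N : Graph) (isT : Fin (m N) → Bool) (lgt : IsLGT N isT) (galled : IsGalledTree N (AllE {N}))
               (C′ : Fin (n N) → Set) (C′? : ∀ ℓ → Dec (C′ ℓ)) where

  Support : Fin (m N) → Set
  Support = SupportE N isT

  Transfer : Fin (m N) → Set
  Transfer e = isT e ≡ true

  transfer⇒¬support : ∀ {e} → Transfer e → ¬ Support e
  transfer⇒¬support t s with () ← trans (sym t) s

  support? : ∀ e → Dec (Support e)
  support? e = isT e ≟B false

  module S = Tree N support? (IsLGT.supportTree lgt)
  module A = Paths N (AllE {N})
  open Paths N Support
  open S using (_⇝?_)
  open Weaken N {Support} {AllE {N}} (λ _ _ → tt)
  open CycleOfPaths N (AllE {N}) (proj₁ (IsLGT.network lgt))
  open Acyclic N (AllE {N}) (proj₁ (IsLGT.network lgt)) using (len>0⇒ends-distinct)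
  open DecidableDegrees N {AllE {N}} (λ _ → yes tt) using (leaf?)

  Allowed : Fin (n N) → Set
  Allowed z = ¬ F N isT C′ z

  allowed? : ∀ z → Dec (Allowed z)
  allowed? z = ¬? (any? λ ℓ → leaf? ℓ ×-dec (z ⇝? ℓ) ×-dec ¬? (C′? ℓ))

  allowed-⇝ : ∀ {z y} → Allowed z → z ⇝ y → Allowed y
  allowed-⇝ allowed π (ℓ , leaf , τ , ℓ∉C) = allowed (ℓ , leaf , π ++ τ , ℓ∉C)

  SameRegion : Fin (n N) → Fin (n N) → Set
  SameRegion x y = ∃ λ z → Allowed z × z ⇝ x × z ⇝ y

  sameRegion? : ∀ x y → Dec (SameRegion x y)
  sameRegion? x y = any? λ z → allowed? z ×-dec (z ⇝? x) ×-dec (z ⇝? y)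

  sameRegion-refl : ∀ {x} → Allowed x → SameRegion x x
  sameRegion-refl allowed = _ , allowed , stop tt , stop tt

  sameRegion-sym : ∀ {x y} → SameRegion x y → SameRegion y x
  sameRegion-sym (z , allowed , z⇝x , z⇝y) = z , allowed , z⇝y , z⇝x

  -- Support ancestors of a common node are comparable, so the lower of the two witnesses works.
  sameRegion-trans : ∀ {x y w} → SameRegion x y → SameRegion y w → SameRegion x w
  sameRegion-trans (z , allowed , z⇝x , z⇝y) (z′ , allowed′ , z′⇝y , z′⇝w) with S.ancestors-comparable z⇝y z′⇝y
  ... | inj₁ z⇝z′ = z , allowed , z⇝x , z⇝z′ ++ z′⇝w
  ... | inj₂ z′⇝z = z′ , allowed′ , z′⇝z ++ z⇝x , z′⇝w

  sameRegion-⇝ : ∀ {a x y} → SameRegion a x → x ⇝ y → SameRegion a y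
  sameRegion-⇝ (z , allowed , z⇝a , z⇝x) x⇝y = z , allowed , z⇝a , z⇝x ++ x⇝y

  Disjoint : ∀ {w x y} → w ⇝ x → w ⇝ y → Set
  Disjoint α β = ∀ i j → 0 < i → 0 < j → node α i ≢ node β j

  -- w is the last node on the root path to z from which y is still reachable.
  fork : ∀ {z x y} (τ : z ⇝ x) → (∀ j → ¬ node τ j ⇝ y) →
         ∃ λ w → Σ (w ⇝ x) λ α → Σ (w ⇝ y) λ β → (∃ λ i → node α i ≡ z) × Disjoint α β
  fork {z} {x} {y} τ τ-avoids with lastVisit (_⇝ y) (_⇝? y) (S.root⇝ z)
  ... | inj₁ none = ⊥-elim (none 0 (S.root⇝ y))
  ... | inj₂ (w , β , σ , σ-avoids) =
    w , σ ++ τ , β , (len σ + 0 , node-++ʳ σ τ 0) ,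
    λ i j i>0 _ eq → ++-avoids (_⇝ y) σ τ σ-avoids τ-avoids i i>0 (subst (_⇝ y) (sym eq) (node⇝end β j))

  record CycleThrough (z : Fin (n N)) (g : Fin (m N)) : Set where
    field
      cycle         : Cycle N (AllE {N})
      z-on          : NodeOn N (AllE {N}) z cycle
      g-on          : EdgeOn N (AllE {N}) g cycle
      sole-transfer : ∀ e → EdgeOn N (AllE {N}) e cycle → Transfer e → e ≡ g

  closeCycle : ∀ {g w z} → Transfer g → (α : w ⇝ src N g) (β : w ⇝ tgt N g) → Disjoint α β →
               (∃ λ i → node α i ≡ z) ⊎ (∃ λ j → node β j ≡ z) → CycleThrough z g
  closeCycle {g} {w} {z} g-transfer α β disjoint z-on = record
    { cycle = PathCycle.cycle C
    ; z-on = [ (λ (i , eq) → subst on eq (α-nodes i))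
             , (λ (j , eq) → subst on (trans (node-weaken β j) eq) (PathCycle.Q-nodes C j)) ]′ z-on
    ; g-on = PathCycle.P-edges C g (A.∈ₑ-++⁺ʳ (weaken α) g⃗ (inj₁ refl))
    ; sole-transfer = sole-transfer
    }
    where
      g⃗ : A._⇝_ (src N g) (tgt N g)
      g⃗ = A.single g tt refl refl
      P Q : A._⇝_ w (tgt N g)
      P = weaken α A.++ g⃗
      Q = weaken β
      |P| : A.len P ≡ suc (len α)
      |P| = trans (A.len-++-single (weaken α) g tt refl refl) (cong suc (len-weaken α))
      P-edges : ∀ {e} → e A.∈ₑ P → e ∈ₑ α ⊎ e ≡ g
      P-edges e∈P = Data.Sum.map (∈ₑ-weaken⁻ α) (A.∈ₑ-single g tt refl refl) (A.∈ₑ-++⁻ (weaken α) g⃗ e∈P)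
      Q-support : ∀ {e} → e A.∈ₑ Q → Support e
      Q-support e∈Q = ∈ₑ⇒E β (∈ₑ-weaken⁻ β e∈Q)
      node-P : ∀ i → i ≤ len α → A.node P i ≡ node α i
      node-P i i≤ = trans (A.node-++ˡ (weaken α) g⃗ i (subst (i ≤_) (sym (len-weaken α)) i≤)) (node-weaken α i)
      C : PathCycle P Q
      C = pathCycle P Q
        (len>0⇒ends-distinct P (subst (0 <_) (sym |P|) (s≤s z≤n)))
        (λ i j i>0 i<|P| j>0 _ eq → disjoint i j i>0 j>0
          (trans (sym (node-P i (s≤s⁻¹ (subst (i <_) |P| i<|P|)))) (trans eq (node-weaken β j))))
        λ f |P|≡1 _ f∈P f∈Q → case P-edges f∈P of λ where
          (inj₁ f∈α) → <-irrefl (sym (suc-injective (trans (sym |P|) |P|≡1))) (∈ₑ⇒len>0 α f∈α)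
          (inj₂ refl) → transfer⇒¬support g-transfer (Q-support f∈Q)
      on : Fin (n N) → Set
      on x = NodeOn N (AllE {N}) x (PathCycle.cycle C)
      α-nodes : ∀ i → on (node α i)
      α-nodes i =
        let j , j≤ , eq = node-within α i in
        subst on (trans (node-P j j≤) eq) (PathCycle.P-nodes C j)
      sole-transfer : ∀ e → EdgeOn N (AllE {N}) e (PathCycle.cycle C) → Transfer e → e ≡ g
      sole-transfer e e-on e-transfer with PathCycle.edges C e e-on
      ... | inj₂ e∈Q = ⊥-elim (transfer⇒¬support e-transfer (Q-support e∈Q))
      ... | inj₁ e∈P with P-edges e∈P
      ...   | inj₁ e∈α = ⊥-elim (transfer⇒¬support e-transfer (∈ₑ⇒E α e∈α))
      ...   | inj₂ e≡g = e≡g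

  Crossing : Fin (m N) → Set
  Crossing g = Transfer g × ¬ SameRegion (src N g) (tgt N g)

  Above : Fin (n N) → Fin (m N) → Set
  Above z g = z ⇝ src N g ⊎ z ⇝ tgt N g

  cycleThrough : ∀ {g z} → Crossing g → Allowed z → Above z g → CycleThrough z g
  cycleThrough {z = z} (g-transfer , apart) allowed (inj₁ τ) =
    let _ , α , β , z∈α , disjoint = fork τ λ j r → apart (z , allowed , τ , start⇝node τ j ++ r) in
    closeCycle g-transfer α β disjoint (inj₁ z∈α)
  cycleThrough {z = z} (g-transfer , apart) allowed (inj₂ τ) =
    let _ , β , α , z∈β , disjoint = fork τ λ j r → apart (z , allowed , start⇝node τ j ++ r , τ) in
    closeCycle g-transfer α β (λ i j i>0 j>0 eq → disjoint j i j>0 i>0 (sym eq)) (inj₂ z∈β)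

  -- Two such cycles share z, so in a galled tree they have the same edges, hence the same transfer edge.
  crossing-unique : ∀ {g h z} → Crossing g → Crossing h → Allowed z → Above z g → Above z h → g ≡ h
  crossing-unique {g} {h} {z} g-crossing h-crossing allowed z-g z-h =
    decidable-stable (g ≟F h) λ g≢h →
      proj₂ galled (cycle Cg) (cycle Ch)
        (λ same → g≢h (sole-transfer Ch g (proj₁ (same g) (g-on Cg)) (proj₁ g-crossing)))
        (z , z-on Cg , z-on Ch)
    where
      open CycleThrough
      Cg : CycleThrough z g
      Cg = cycleThrough g-crossing allowed z-g
      Ch : CycleThrough z h
      Ch = cycleThrough h-crossing allowed z-h

  CrossedOnce : Fin (n N) → Fin (n N) → Set
  CrossedOnce u x = ∃ λ g → Crossing g × SameRegion u (src N g) × SameRegion (tgt N g) x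

  WithinOneCrossing : Fin (n N) → Fin (n N) → Set
  WithinOneCrossing u x = SameRegion u x ⊎ CrossedOnce u x

  within-sameRegion : ∀ {u x y} → WithinOneCrossing u x → SameRegion x y → WithinOneCrossing u y
  within-sameRegion (inj₁ u~x) x~y = inj₁ (sameRegion-trans u~x x~y)
  within-sameRegion (inj₂ (g , g-crossing , u~g , g~x)) x~y = inj₂ (g , g-crossing , u~g , sameRegion-trans g~x x~y)

  within-⇝ : ∀ {u x y} → WithinOneCrossing u x → x ⇝ y → WithinOneCrossing u y
  within-⇝ (inj₁ u~x) x⇝y = inj₁ (sameRegion-⇝ u~x x⇝y)
  within-⇝ (inj₂ (g , g-crossing , u~g , g~x)) x⇝y = inj₂ (g , g-crossing , u~g , sameRegion-⇝ g~x x⇝y)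

  -- A second crossing e would leave the region entered through g, so e = g by crossing-unique.
  within-cross : ∀ {u e} → Crossing e → Allowed (tgt N e) →
                 WithinOneCrossing u (src N e) → WithinOneCrossing u (tgt N e)
  within-cross e-crossing allowed (inj₁ u~e) = inj₂ (_ , e-crossing , u~e , sameRegion-refl allowed)
  within-cross {e = e} e-crossing allowed (inj₂ (g , g-crossing , u~g , (z , allowed-z , z⇝g , z⇝e))) =
    inj₂ (g , g-crossing , u~g , subst (λ h → SameRegion (tgt N h) (tgt N e)) (sym g≡e) (sameRegion-refl allowed))
    where
      g≡e : g ≡ e
      g≡e = crossing-unique g-crossing e-crossing allowed-z (inj₂ z⇝g) (inj₁ z⇝e)

  within-path : ∀ {u x y} → Path N (AllE {N}) Allowed x y → WithinOneCrossing u x → WithinOneCrossing u y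
  within-path (stop _) within = within
  within-path (step e _ refl _ π) within with isT e in e-kind
  ... | false = within-path π (within-⇝ within (single e e-kind refl refl))
  ... | true with sameRegion? (src N e) (tgt N e)
  ...   | yes same = within-path π (within-sameRegion within same)
  ...   | no apart = within-path π (within-cross (e-kind , apart) (A.node-Q π 0) within)

  crossedOnce-sameRegion : ∀ {u x y} → CrossedOnce u x → CrossedOnce u y → SameRegion x y
  crossedOnce-sameRegion {y = y} (g , g-crossing , u~g , g~x) (h , h-crossing , u~h , h~y) =
    sameRegion-trans (sameRegion-sym g~x) (subst (λ k → SameRegion (tgt N k) y) (sym g≡h) h~y)
    where
      g≡h : g ≡ h
      g≡h with z , allowed , z⇝g , z⇝h ← sameRegion-trans (sameRegion-sym u~g) u~h =
        crossing-unique g-crossing h-crossing allowed (inj₁ z⇝g) (inj₁ z⇝h)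

  within-pigeonhole : ∀ {u a b c} → WithinOneCrossing u a → WithinOneCrossing u b → WithinOneCrossing u c →
                      SameRegion a b ⊎ SameRegion a c ⊎ SameRegion b c
  within-pigeonhole (inj₁ ua) (inj₁ ub) _ = inj₁ (sameRegion-trans (sameRegion-sym ua) ub)
  within-pigeonhole (inj₂ ua) (inj₂ ub) _ = inj₁ (crossedOnce-sameRegion ua ub)
  within-pigeonhole (inj₁ ua) (inj₂ _) (inj₁ uc) = inj₂ (inj₁ (sameRegion-trans (sameRegion-sym ua) uc))
  within-pigeonhole (inj₁ _) (inj₂ ub) (inj₂ uc) = inj₂ (inj₂ (crossedOnce-sameRegion ub uc))
  within-pigeonhole (inj₂ _) (inj₁ ub) (inj₁ uc) = inj₂ (inj₂ (sameRegion-trans (sameRegion-sym ub) uc))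
  within-pigeonhole (inj₂ ua) (inj₁ _) (inj₂ uc) = inj₂ (inj₁ (crossedOnce-sameRegion ua uc))

  explained-pigeonhole : Explains N isT C′ → ∀ {a b c} → C′ a → C′ b → C′ c →
                         SameRegion a b ⊎ SameRegion a c ⊎ SameRegion b c
  explained-pigeonhole (u , allowed , path) a∈C b∈C c∈C =
    within-pigeonhole (reach a∈C) (reach b∈C) (reach c∈C)
    where
      reach : ∀ {ℓ} → C′ ℓ → WithinOneCrossing u ℓ
      reach {ℓ} ℓ∈C = within-path (path ℓ ℓ∈C) (inj₁ (sameRegion-refl allowed))

module FirstAppearance (T : Graph) (tree : IsTree T (AllE {T})) (C : Character T) where
  open Paths T (AllE {T})
  open Tree T {AllE {T}} (λ _ → yes tt) tree
  open DecidableDegrees T {AllE {T}} (λ _ → yes tt)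

  LeavesInC : Fin (n T) → Set
  LeavesInC = LeavesBelowIn T C

  LeavesInC-⇝ : ∀ {x y} → x ⇝ y → LeavesInC x → LeavesInC y
  LeavesInC-⇝ x⇝y all-in ℓ leaf y⇝ℓ = all-in ℓ leaf (x⇝y ++ y⇝ℓ)

  LeavesInC? : ∀ v → Dec (LeavesInC v)
  LeavesInC? v = all? λ ℓ → leaf? ℓ →-dec (v ⇝? ℓ) →-dec (C ℓ ≟B true)

  IsFA? : ∀ v → Dec (IsFA T C v)
  IsFA? v = LeavesInC? v ×-dec (inDeg0? v ⊎-dec any? λ e → (tgt T e ≟F v) ×-dec ¬? (LeavesInC? (src T e)))

  -- The parent of x lies on any path from a proper ancestor y, and inherits LeavesInC from y.
  FA-maximal : ∀ {x y} → IsFA T C x → LeavesInC y → y ⇝ x → y ≢ x → ⊥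
  FA-maximal (_ , parent) all-in y⇝x y≢x with last-edge y⇝x | parent
  ... | inj₁ (y≡x , _) | _ = y≢x y≡x
  ... | inj₂ (e , _ , te , y⇝p , _) | inj₁ root = root e tt te
  ... | inj₂ (e , _ , te , y⇝p , _) | inj₂ (e′ , te′ , ¬in-C)
    with refl ← in-edge-unique e′ e tt tt (trans te′ (sym te)) = ¬in-C (LeavesInC-⇝ y⇝p all-in)

  FA-above : ∀ {x y ℓ} → IsFA T C x → LeavesInC y → x ⇝ ℓ → y ⇝ ℓ → x ⇝ y
  FA-above {x} {y} fa all-in x⇝ℓ y⇝ℓ with ancestors-comparable x⇝ℓ y⇝ℓ | y ≟F x
  ... | inj₁ x⇝y | _ = x⇝y
  ... | inj₂ _ | yes refl = stop tt
  ... | inj₂ y⇝x | no y≢x = ⊥-elim (FA-maximal fa all-in y⇝x y≢x)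

  FA-separated : ∀ {x x′ y ℓ ℓ′} → IsFA T C x → IsFA T C x′ → x ≢ x′ → x ⇝ ℓ → x′ ⇝ ℓ′ →
                 LeavesInC y → y ⇝ ℓ → y ⇝ ℓ′ → ⊥
  FA-separated fa fa′ x≢x′ x⇝ℓ x′⇝ℓ′ all-in y⇝ℓ y⇝ℓ′ =
    FA-maximal fa′ (proj₁ fa) (FA-above fa (proj₁ fa′) (FA-above fa all-in x⇝ℓ y⇝ℓ ++ y⇝ℓ′) x′⇝ℓ′) x≢x′

  -- A sink that is not a leaf has in-degree 0, so it is the root; then it would have no descendant y.
  leaf-below : ∀ {x y} → y ≢ x → ∃ λ ℓ → Leaf T (AllE {T}) ℓ × x ⇝ ℓ
  leaf-below {x} {y} y≢x with ⇝sink x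
  ... | ℓ , out0 , x⇝ℓ with any? (λ e → tgt T e ≟F ℓ)
  ...   | yes (e , te) = ℓ , ((e , tt , te , λ e′ _ te′ → in-edge-unique e′ e tt tt (trans te′ (sym te))) , out0) , x⇝ℓ
  ...   | no ∄ with last-edge x⇝ℓ
  ...     | inj₂ (e , _ , te , _) = ⊥-elim (∄ (e , te))
  ...     | inj₁ (refl , _) =
    let x≡root = proj₂ (proj₂ (proj₂ (proj₁ tree))) x λ e _ te → ∄ (e , te)
        root⇝y = root⇝ y
        e , _ , se , _ = edgeAt root⇝y 0 (ends-distinct⇒len>0 root⇝y λ root≡y → y≢x (trans (sym root≡y) (sym x≡root))) in
    ⊥-elim (out0 e tt (trans se (sym x≡root)))

module Embedding (T N : Graph) (isT : Fin (m N) → Bool) (φ : Fin (n T) → Fin (n N)) (iso : BaseTreeIso T N isT φ) where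
  open BaseTreeIso iso
  module S = Paths N (SupportE N isT)
  module TP = Paths T (AllE {T})
  open S using (_⇝_; _++_)
  open DecidableDegrees N {SupportE N isT} (λ e → isT e ≟B false) using (subdiv?)

  Image : Fin (n N) → Set
  Image a = ∃ λ x → φ x ≡ a

  ¬image⇒subdiv : ∀ {a} → ¬ Image a → Subdiv N (SupportE N isT) a
  ¬image⇒subdiv {a} ¬image = decidable-stable (subdiv? a) λ ¬subdiv → ¬image (φ-onto a ¬subdiv)

  suppEdge⇒⇝ : ∀ {a b} → SuppEdge N (SupportE N isT) a b → a ⇝ b
  suppEdge⇒⇝ (direct e Ee se te) = S.single e Ee se te
  suppEdge⇒⇝ (via e Ee se _ rest) = step e Ee se tt (suppEdge⇒⇝ rest)

  suppEdge-snoc : ∀ {a b} → SuppEdge N (SupportE N isT) a b → Subdiv N (SupportE N isT) b →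
                  ∀ e → SupportE N isT e → src N e ≡ b → SuppEdge N (SupportE N isT) a (tgt N e)
  suppEdge-snoc (direct e₀ E₀ s₀ refl) subdiv e Ee se = via e₀ E₀ s₀ subdiv (direct e Ee se refl)
  suppEdge-snoc (via e₀ E₀ s₀ subdiv₀ rest) subdiv e Ee se = via e₀ E₀ s₀ subdiv₀ (suppEdge-snoc rest subdiv e Ee se)

  φ-⇝ : ∀ {x y} → x TP.⇝ y → φ x ⇝ φ y
  φ-⇝ (stop _) = stop tt
  φ-⇝ (step e _ refl _ π) = suppEdge⇒⇝ (φ-edge (src T e) (tgt T e) (e , tt , refl , refl)) ++ φ-⇝ π

  -- A support path between images is cut at the images on it into suppressed edges, i.e. edges of T.
  private
    mutual
      reflect-from : ∀ {x a t} y → SuppEdge N (SupportE N isT) (φ x) a → a ⇝ t → t ≡ φ y → x TP.⇝ y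
      reflect-from {x} {a} y edge π t≡φy with any? (λ v → φ v ≟F a)
      ... | yes (v , refl) =
        let e , _ , se , te = φ-edge⁻¹ x v edge in
        TP.single e tt se te TP.++ reflect-at v y refl π t≡φy
      ... | no ¬image with π
      ...   | stop _ = ⊥-elim (¬image (y , sym t≡φy))
      ...   | step e Ee se _ π′ = reflect-from y (suppEdge-snoc edge (¬image⇒subdiv ¬image) e Ee se) π′ t≡φy

      reflect-at : ∀ {a t} x y → φ x ≡ a → a ⇝ t → t ≡ φ y → x TP.⇝ y
      reflect-at x y refl (stop _) φx≡φy = subst (x TP.⇝_) (φ-inj φx≡φy) (stop tt)
      reflect-at x y refl (step e Ee se _ π) t≡φy = reflect-from y (direct e Ee se refl) π t≡φy

  φ-⇝⁻¹ : ∀ {x y} → φ x ⇝ φ y → x TP.⇝ y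
  φ-⇝⁻¹ {x} {y} π = reflect-at x y refl π refl

  -- Above a non-image node the support tree does not branch.
  image-below : ∀ {z t t′} → z ⇝ t → z ⇝ t′ → Image t → Image t′ → ∃ λ y → z ⇝ φ y × φ y ⇝ t × φ y ⇝ t′
  image-below {z} π π′ t-image t′-image with any? (λ v → φ v ≟F z)
  ... | yes (y , refl) = y , stop tt , π , π′
  ... | no ¬image with ¬image⇒subdiv ¬image | π | π′
  ...   | _ | stop _ | _ = ⊥-elim (¬image t-image)
  ...   | _ | step _ _ _ _ _ | stop _ = ⊥-elim (¬image t′-image)
  ...   | _ , _ , _ , _ , out-unique | step e₁ E₁ s₁ _ π₁ | step e₂ E₂ s₂ _ π₂
    with refl ← trans (out-unique e₁ E₁ s₁) (sym (out-unique e₂ E₂ s₂)) =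
    let y , z⇝y , y⇝t , y⇝t′ = image-below π₁ π₂ t-image t′-image in
    y , step e₁ E₁ s₁ tt z⇝y , y⇝t , y⇝t′

module FAInGalledTree (T : Graph) (tree : IsTree T (AllE {T}))
  (N : Graph) (isT : Fin (m N) → Bool) (φ : Fin (n T) → Fin (n N))
  (lgt : IsLGT N isT) (galled : IsGalledTree N (AllE {N})) (iso : BaseTreeIso T N isT φ)
  (C : Character T) where

  open BaseTreeIso iso
  open FirstAppearance T tree C
  open Embedding T N isT φ iso

  C′ : Fin (n N) → Set
  C′ = transport T N φ C

  C′? : ∀ ℓ → Dec (C′ ℓ)
  C′? ℓ = any? λ v → (φ v ≟F ℓ) ×-dec (C v ≟B true)

  open Regions N isT lgt galled C′ C′?

  allowed⇒LeavesInC : ∀ {y} → Allowed (φ y) → LeavesInC y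
  allowed⇒LeavesInC allowed ℓ leaf y⇝ℓ = decidable-stable (C ℓ ≟B true) λ ℓ∉C →
    allowed (φ ℓ , leaf-to ℓ leaf , φ-⇝ y⇝ℓ , λ (v , φv≡φℓ , v∈C) → ℓ∉C (subst (λ w → C w ≡ true) (φ-inj φv≡φℓ) v∈C))

  FA-leaves-apart : ∀ {x x′ ℓ ℓ′} → IsFA T C x → IsFA T C x′ → x ≢ x′ → x TP.⇝ ℓ → x′ TP.⇝ ℓ′ →
                    ¬ SameRegion (φ ℓ) (φ ℓ′)
  FA-leaves-apart {ℓ = ℓ} {ℓ′} fa fa′ x≢x′ x⇝ℓ x′⇝ℓ′ (z , allowed , z⇝ℓ , z⇝ℓ′) =
    let y , z⇝y , y⇝ℓ , y⇝ℓ′ = image-below z⇝ℓ z⇝ℓ′ (ℓ , refl) (ℓ′ , refl) in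
    FA-separated fa fa′ x≢x′ x⇝ℓ x′⇝ℓ′ (allowed⇒LeavesInC (allowed-⇝ allowed z⇝y)) (φ-⇝⁻¹ y⇝ℓ) (φ-⇝⁻¹ y⇝ℓ′)

  no-three-FA : Explains N isT C′ → ∀ x₁ x₂ x₃ → IsFA T C x₁ → IsFA T C x₂ → IsFA T C x₃ →
                x₁ ≢ x₂ → x₁ ≢ x₃ → x₂ ≢ x₃ → ⊥
  no-three-FA explains x₁ x₂ x₃ fa₁ fa₂ fa₃ x₁≢x₂ x₁≢x₃ x₂≢x₃
    with ℓ₁ , leaf₁ , x₁⇝ℓ₁ ← leaf-below (λ x₂≡x₁ → x₁≢x₂ (sym x₂≡x₁))
       | ℓ₂ , leaf₂ , x₂⇝ℓ₂ ← leaf-below x₁≢x₂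
       | ℓ₃ , leaf₃ , x₃⇝ℓ₃ ← leaf-below x₁≢x₃
    with explained-pigeonhole explains (in-C fa₁ leaf₁ x₁⇝ℓ₁) (in-C fa₂ leaf₂ x₂⇝ℓ₂) (in-C fa₃ leaf₃ x₃⇝ℓ₃)
    where
      in-C : ∀ {x ℓ} → IsFA T C x → Leaf T (AllE {T}) ℓ → x TP.⇝ ℓ → C′ (φ ℓ)
      in-C (all-in , _) leaf x⇝ℓ = _ , refl , all-in _ leaf x⇝ℓ
  ... | inj₁ same = FA-leaves-apart fa₁ fa₂ x₁≢x₂ x₁⇝ℓ₁ x₂⇝ℓ₂ same
  ... | inj₂ (inj₁ same) = FA-leaves-apart fa₁ fa₃ x₁≢x₃ x₁⇝ℓ₁ x₃⇝ℓ₃ same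
  ... | inj₂ (inj₂ same) = FA-leaves-apart fa₂ fa₃ x₂≢x₃ x₂⇝ℓ₂ x₃⇝ℓ₃ same

lemma5 : (T : Graph) → IsTree T (AllE {T}) → (∀ v → ¬ Subdiv T (AllE {T}) v) →
         (𝒞 : Character T → Set) → (∀ C → 𝒞 C → IsCharacter T C) →
         GalledCompletable T 𝒞 →
         ∀ C → 𝒞 C → ∃[ xs ] (length xs ≤ 2 × (∀ v → IsFA T C v → v ∈ xs))
lemma5 T tree _ 𝒞 _ (N , isT , φ , lgt , galled , iso , explains) C C∈𝒞 =
  at-most-two IsFA? (no-three-FA (explains C C∈𝒞))
  where
    open FirstAppearance T tree C using (IsFA?)
    open FAInGalledTree T tree N isT φ lgt galled iso C using (no-three-FA)
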